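{- Let $X$ be a complex and let $F:X\to\mathbb Z$ be a map. Then $F$ is a Morse stack on $X$ if and only if $-F$ is a flat discrete Morse function on $X$.
   Context: A simplex is a non-empty finite set; its dimension is its cardinality minus one. A complex is a finite set $X$ of simplexes closed under taking non-empty subsets; its elements are faces. A covering pair of $X$ is a pair $(x,y)$ of faces with $x\subseteq y$ and $\dim x=\dim y-1$. A stack on $X$ is a map $F:X\to\mathbb Z$ with $F(x)\ge F(y)$ whenever $x\subseteq y$. A flat pair of a map $F$ is a covering pair $(x,y)$ with $F(x)=F(y)$. A stack $F$ is a Morse stack if each face of $X$ lies in at most one flat pair of $F$. A map $G:X\to\mathbb Z$ is a discrete Morse function if each face of $X$ lies in at most one covering pair $(x,y)$ with $G(x)\ge G(y)$ (such pairs are called regular pairs of $G$); it is flat if $G(x)=G(y)$ for every regular pair $(x,y)$ of $G$. -}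

module Defs where

open import Data.Nat using (ℕ; suc; _<_)
open import Data.Integer using (ℤ; _≤_; -_)
open import Data.List using (List; length)
open import Data.List.Relation.Unary.All using (All)
open import Data.List.Relation.Unary.Linked using (Linked)
open import Data.List.Membership.Propositional using (_∈_)
open import Data.List.Relation.Binary.Subset.Propositional using (_⊆_)
open import Data.Product using (_×_)
open import Data.Sum using (_⊎_)
open import Relation.Binary.PropositionalEquality using (_≡_)

-- Vertices are natural numbers. A simplex (non-empty finite set of vertices)
-- is represented canonically by a non-empty strictly increasing list.
data NonEmpty {A : Set} : List A → Set where
  nonEmpty : ∀ {a as} → NonEmpty (a Data.List.∷ as)

IsSimplex : List ℕ → Set
IsSimplex s = NonEmpty s × Linked _<_ s

record Complex : Set where
  field
    faces     : List (List ℕ)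
    simplexes : All IsSimplex faces
    closed    : ∀ {x y} → y ∈ faces → IsSimplex x → x ⊆ y → x ∈ faces
open Complex public

-- dim x = dim y - 1  ⇔  |y| = |x| + 1
CoveringPair : Complex → List ℕ → List ℕ → Set
CoveringPair X x y = x ∈ faces X × y ∈ faces X × x ⊆ y × length y ≡ suc (length x)

Stack : Complex → (List ℕ → ℤ) → Set
Stack X F = ∀ {x y} → x ∈ faces X → y ∈ faces X → x ⊆ y → F y ≤ F x

FlatPair : Complex → (List ℕ → ℤ) → List ℕ → List ℕ → Set
FlatPair X F x y = CoveringPair X x y × F x ≡ F y

RegularPair : Complex → (List ℕ → ℤ) → List ℕ → List ℕ → Set
RegularPair X G x y = CoveringPair X x y × G y ≤ G x

AtMostOnePair : Complex → (List ℕ → List ℕ → Set) → Set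
AtMostOnePair X P = ∀ {z x y x′ y′} → z ∈ faces X →
  P x y → P x′ y′ → (z ≡ x ⊎ z ≡ y) → (z ≡ x′ ⊎ z ≡ y′) → x ≡ x′ × y ≡ y′

MorseStack : Complex → (List ℕ → ℤ) → Set
MorseStack X F = Stack X F × AtMostOnePair X (FlatPair X F)

DiscreteMorseFunction : Complex → (List ℕ → ℤ) → Set
DiscreteMorseFunction X G = AtMostOnePair X (RegularPair X G)

Flat : Complex → (List ℕ → ℤ) → Set
Flat X G = ∀ {x y} → RegularPair X G x y → G x ≡ G y

FlatDiscreteMorseFunction : Complex → (List ℕ → ℤ) → Set
FlatDiscreteMorseFunction X G = DiscreteMorseFunction X G × Flat X G

negate : (List ℕ → ℤ) → (List ℕ → ℤ)
negate F s = - F s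

{-# OPTIONS --safe #-}
module Submission where

-- A covering pair is regular for -F exactly when F does not decrease along it. If F is a stack
-- this forces equality, so the regular pairs of -F are precisely the flat pairs of F.
-- Conversely, if -F is flat, F strictly decreases along every non-flat covering pair; and F
-- decreases along every inclusion x ⊆ y of faces, because deleting from y a vertex missing
-- from x gives a face covered by y and still containing x, so induction on |y| applies.

open import Defs
open import Data.Nat using (ℕ; suc; _<_)
open import Data.Nat.Properties using (_≟_; <-trans; <-irrefl; <-asym; <⇒≢; >⇒≢; ≤-reflexive)
open import Data.Nat.Induction using (<-wellFounded)
open import Data.Integer using (ℤ; -_; _≤_)
open import Data.Integer.Properties as ℤ using (_≤?_)
open import Data.List using (List; []; _∷_; length; filter)
open import Data.List.Properties using (filter-accept; filter-reject; filter-all)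
open import Data.List.Relation.Unary.All as All using (All; all?)
open import Data.List.Relation.Unary.All.Properties using (¬All⇒Any¬)
open import Data.List.Relation.Unary.Any using (here; there)
open import Data.List.Relation.Unary.Any.Properties using (¬Any[])
open import Data.List.Relation.Unary.AllPairs using (AllPairs; []; _∷_)
import Data.List.Relation.Unary.Linked.Properties as Linked
open import Data.List.Membership.Propositional using (_∈_; find)
open import Data.List.Membership.Propositional.Properties using (∈-filter⁺; ∈-filter⁻)
open import Data.List.Membership.DecPropositional _≟_ using (_∈?_)
open import Data.List.Relation.Binary.Subset.Propositional using (_⊆_)
open import Data.Product using (_×_; _,_; proj₁; proj₂)
open import Data.Empty using (⊥-elim)
open import Function.Base using (_∘_)
open import Function.Bundles using (_⇔_; mk⇔)
open import Induction.WellFounded using (Acc; acc)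
open import Relation.Nullary using (¬_; yes; no; ¬?; contradiction)
open import Relation.Binary.PropositionalEquality using (_≡_; refl; sym; cong)
open Relation.Binary.PropositionalEquality.≡-Reasoning

∈-tail : ∀ {a c : ℕ} {as} → c ∈ a ∷ as → a < c → c ∈ as
∈-tail (here refl) a<c = ⊥-elim (<-irrefl refl a<c)
∈-tail (there c∈as) _  = c∈as

sorted-heads-≡ : ∀ {a b : ℕ} {as bs} → All (a <_) as → All (b <_) bs →
                 a ∷ as ⊆ b ∷ bs → b ∷ bs ⊆ a ∷ as → a ≡ b
sorted-heads-≡ a<as b<bs xs⊆ys ys⊆xs with xs⊆ys (here refl) | ys⊆xs (here refl)
... | here a≡b   | _           = a≡b
... | there _    | here b≡a    = sym b≡a
... | there a∈bs | there b∈as  = ⊥-elim (<-asym (All.lookup b<bs a∈bs) (All.lookup a<as b∈as))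

sorted-tail-⊆ : ∀ {a : ℕ} {as bs} → All (a <_) as → a ∷ as ⊆ a ∷ bs → as ⊆ bs
sorted-tail-⊆ a<as xs⊆ys c∈as = ∈-tail (xs⊆ys (there c∈as)) (All.lookup a<as c∈as)

sorted-⊆-antisym : ∀ {xs ys : List ℕ} → AllPairs _<_ xs → AllPairs _<_ ys →
                   xs ⊆ ys → ys ⊆ xs → xs ≡ ys
sorted-⊆-antisym [] [] _ _ = refl
sorted-⊆-antisym [] (_ ∷ _) _ ys⊆xs = contradiction (ys⊆xs (here refl)) ¬Any[]
sorted-⊆-antisym (_ ∷ _) [] xs⊆ys _ = contradiction (xs⊆ys (here refl)) ¬Any[]
sorted-⊆-antisym (a<as ∷ sas) (b<bs ∷ sbs) xs⊆ys ys⊆xs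
  with sorted-heads-≡ a<as b<bs xs⊆ys ys⊆xs
... | refl = cong (_ ∷_) (sorted-⊆-antisym sas sbs (sorted-tail-⊆ a<as xs⊆ys)
                                                   (sorted-tail-⊆ b<bs ys⊆xs))

remove : ℕ → List ℕ → List ℕ
remove v = filter (λ c → ¬? (c ≟ v))

length-remove : ∀ {v ys} → AllPairs _<_ ys → v ∈ ys → length ys ≡ suc (length (remove v ys))
length-remove {v} {a ∷ as} (a<as ∷ _) (here refl) = cong (suc ∘ length) (sym removed)
  where
  removed : remove a (a ∷ as) ≡ as
  removed = begin
    remove a (a ∷ as) ≡⟨ filter-reject (λ c → ¬? (c ≟ a)) (λ a≢a → a≢a refl) ⟩
    remove a as       ≡⟨ filter-all (λ c → ¬? (c ≟ a)) (All.map >⇒≢ a<as) ⟩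
    as                ∎
length-remove {v} {a ∷ as} (a<as ∷ sas) (there v∈as) = begin
  suc (length as)                   ≡⟨ cong suc (length-remove sas v∈as) ⟩
  suc (suc (length (remove v as)))  ≡⟨ cong (suc ∘ length)
                                         (sym (filter-accept (λ c → ¬? (c ≟ v)) a≢v)) ⟩
  suc (length (remove v (a ∷ as)))  ∎
  where
  a≢v : ¬ a ≡ v
  a≢v = <⇒≢ (All.lookup a<as v∈as)

∈⇒NonEmpty : ∀ {c : ℕ} {cs} → c ∈ cs → NonEmpty cs
∈⇒NonEmpty (here _)  = nonEmpty
∈⇒NonEmpty (there _) = nonEmpty

face-sorted : (X : Complex) → ∀ {x} → x ∈ faces X → AllPairs _<_ x
face-sorted X x∈X = Linked.Linked⇒AllPairs <-trans (proj₂ (All.lookup (simplexes X) x∈X))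

remove-face : (X : Complex) → ∀ {v x y} → x ∈ faces X → y ∈ faces X → x ⊆ y → ¬ v ∈ x →
              remove v y ∈ faces X × x ⊆ remove v y
remove-face X {v} {x} {y} x∈X y∈X x⊆y v∉x = closed X y∈X simplex (proj₁ ∘ ∈-filter⁻ _) , x⊆y′
  where
  x⊆y′ : x ⊆ remove v y
  x⊆y′ c∈x = ∈-filter⁺ _ (x⊆y c∈x) (λ { refl → v∉x c∈x })
  simplex : IsSimplex (remove v y)
  simplex with All.lookup (simplexes X) x∈X | All.lookup (simplexes X) y∈X
  ... | nonEmpty , _ | _ , y-sorted =
    ∈⇒NonEmpty (x⊆y′ (here refl)) , Linked.filter⁺ _ <-trans y-sorted

AtMostOnePair-antimono : (X : Complex) → ∀ {P Q : List ℕ → List ℕ → Set} →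
                         (∀ {x y} → P x y → Q x y) → AtMostOnePair X Q → AtMostOnePair X P
AtMostOnePair-antimono X P⇒Q unique z∈X p p′ = unique z∈X (P⇒Q p) (P⇒Q p′)

module _ (X : Complex) (F : List ℕ → ℤ) where

  covering-antitone⇒stack : (∀ {x y} → CoveringPair X x y → F y ≤ F x) → Stack X F
  covering-antitone⇒stack antitone {y = y} = go (<-wellFounded (length y))
    where
    go : ∀ {x y} → Acc _<_ (length y) → x ∈ faces X → y ∈ faces X → x ⊆ y → F y ≤ F x
    go {x} {y} (acc shorter) x∈X y∈X x⊆y with all? (_∈? x) y
    ... | yes y⊆x = ℤ.≤-reflexive (cong F (sym x≡y))
      where
      x≡y : x ≡ y
      x≡y = sorted-⊆-antisym (face-sorted X x∈X) (face-sorted X y∈X) x⊆y (All.lookup y⊆x)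
    ... | no y⊈x with find (¬All⇒Any¬ (_∈? x) y y⊈x)
    ...   | v , v∈y , v∉x with remove-face X x∈X y∈X x⊆y v∉x
    ...     | y′∈X , x⊆y′ =
      ℤ.≤-trans (antitone (y′∈X , y∈X , proj₁ ∘ ∈-filter⁻ _ , length-y))
                (go (shorter (≤-reflexive (sym length-y))) x∈X y′∈X x⊆y′)
      where
      length-y : length y ≡ suc (length (remove v y))
      length-y = length-remove (face-sorted X y∈X) v∈y

  regular⇒flat : Stack X F → ∀ {x y} → RegularPair X (negate F) x y → FlatPair X F x y
  regular⇒flat stack (covering@(x∈X , y∈X , x⊆y , _) , -Fy≤-Fx) =
    covering , ℤ.≤-antisym (ℤ.neg-cancel-≤ -Fy≤-Fx) (stack x∈X y∈X x⊆y)

  flat⇒regular : ∀ {x y} → FlatPair X F x y → RegularPair X (negate F) x y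
  flat⇒regular (covering , Fx≡Fy) = covering , ℤ.≤-reflexive (cong -_ (sym Fx≡Fy))

  flat⇒covering-antitone : Flat X (negate F) → ∀ {x y} → CoveringPair X x y → F y ≤ F x
  flat⇒covering-antitone flat {x} {y} covering with negate F y ≤? negate F x
  ... | yes -Fy≤-Fx = ℤ.≤-reflexive (sym (ℤ.neg-injective (flat (covering , -Fy≤-Fx))))
  ... | no -Fy≰-Fx  = ℤ.<⇒≤ (ℤ.neg-cancel-< (ℤ.≰⇒> -Fy≰-Fx))

proposition9 : (X : Complex) (F : List ℕ → ℤ) →
    MorseStack X F ⇔ FlatDiscreteMorseFunction X (negate F)
proposition9 X F = mk⇔ to from
  where
  to : MorseStack X F → FlatDiscreteMorseFunction X (negate F)
  to (stack , unique) =
    AtMostOnePair-antimono X (regular⇒flat X F stack) unique ,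
    cong -_ ∘ proj₂ ∘ regular⇒flat X F stack
  from : FlatDiscreteMorseFunction X (negate F) → MorseStack X F
  from (unique , flat) =
    covering-antitone⇒stack X F (flat⇒covering-antitone X F flat) ,
    AtMostOnePair-antimono X (flat⇒regular X F) unique
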